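{- Let $n=4m+r$ with $m\geq 1$ and $r\in\{0,1,2,3\}$. Then $q_3(4m)\leq 4m$, $q_3(4m+1)\leq 4m$, $q_3(4m+2)\leq 4m+3$, and $q_3(4m+3)\leq 4m+3$.
   Context: There are $n$ balls with distinct identities, each colored with one of two colors; the coloring is unknown to a questioner. A color is the majority color if strictly more than half of the balls have it. The majority problem is: determine with certainty whether a majority color exists, and if it does, output a ball of the majority color. The questioner may adaptively ask triple queries in the Y/N model: choose a set of $3$ distinct balls and receive the answer YES if all three have the same color and NO otherwise (answers are consistent with the hidden coloring and may be adversarial). $q_3(n)$ denotes the minimum number of such queries that suffice in the worst case to solve the majority problem for $n$ balls. -}

module Defs where

open import Data.Nat using (ℕ; zero; suc; _+_; _*_; _≤_; _<_; _⊔_)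
open import Data.Bool using (Bool; true; false; _∧_; if_then_else_)
open import Data.Bool.Properties using () renaming (_≟_ to _≟ᵇ_)
open import Data.Fin using (Fin; zero; suc)
open import Data.Maybe using (Maybe; just; nothing)
open import Data.Product using (Σ; ∃; _×_; _,_)
open import Relation.Nullary using (¬_)
open import Relation.Nullary.Decidable using (⌊_⌋)
open import Relation.Binary.PropositionalEquality using (_≡_; _≢_)

Coloring : ℕ → Set
Coloring n = Fin n → Bool

count : ∀ {n} → Coloring n → Bool → ℕ
count {zero}  c col = 0
count {suc n} c col =
  (if ⌊ c zero ≟ᵇ col ⌋ then 1 else 0) + count {n} (λ i → c (suc i)) col

IsMajority : ∀ {n} → Coloring n → Bool → Set
IsMajority {n} c col = n < 2 * count c col

HasMajority : ∀ {n} → Coloring n → Set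
HasMajority c = ∃ λ col → IsMajority c col

tripleAnswer : ∀ {n} → Coloring n → Fin n → Fin n → Fin n → Bool
tripleAnswer c a b d = ⌊ c a ≟ᵇ c b ⌋ ∧ ⌊ c b ≟ᵇ c d ⌋

-- Adaptive strategies as decision trees.
-- Leaf output: nothing = "no majority color", just i = "ball i has the majority color".
data Strategy (n : ℕ) : Set where
  leaf  : Maybe (Fin n) → Strategy n
  query : (a b d : Fin n) → a ≢ b → a ≢ d → b ≢ d →
          (ifYes ifNo : Strategy n) → Strategy n

depth : ∀ {n} → Strategy n → ℕ
depth (leaf _) = 0
depth (query _ _ _ _ _ _ y no) = suc (depth y ⊔ depth no)

run : ∀ {n} → Strategy n → Coloring n → Maybe (Fin n)
run (leaf o) c = o
run (query a b d _ _ _ y no) c with tripleAnswer c a b d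
... | true  = run y c
... | false = run no c

CorrectOutput : ∀ {n} → Coloring n → Maybe (Fin n) → Set
CorrectOutput c nothing  = ¬ HasMajority c
CorrectOutput c (just i) = IsMajority c (c i)

Solves : ∀ {n} → Strategy n → Set
Solves {n} t = (c : Coloring n) → CorrectOutput c (run t c)

q3≤ : ℕ → ℕ → Set
q3≤ n k = Σ (Strategy n) λ t → depth t ≤ k × Solves t

-- Scan the balls in groups of four. The four triples of a group either all get NO, so the group
-- splits 2–2 and can be discarded without changing the answer, or exhibit two balls x, y of one
-- colour and the colours of the whole group relative to x. In the latter case one query {x, y, z}
-- per remaining ball z reveals the colouring up to swapping the colours, which settles the problem.
-- This gives q₃(4m) ≤ 4m, and q₃(4m + 2) ≤ 4m + 3 from a base case of six balls whose balanced
-- group needs three more queries. Finally q₃(2h + 1) ≤ q₃(2h): ignore one ball; a majority of the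
-- other 2h balls is a majority of all, and if they tie, the colour of the extra ball wins.

module Submission where

open import Defs
open import Data.Bool using (Bool; true; false; not; _∧_; T; if_then_else_)
open import Data.Bool.Properties using (T-∧) renaming (_≟_ to _≟ᵇ_)
open import Data.Fin using (Fin; zero; suc; _↑ˡ_; _↑ʳ_; splitAt)
open import Data.Fin.Patterns using (0F; 1F; 2F; 3F; 4F; 5F)
open import Data.Fin.Properties
  using (suc-injective; ↑ˡ-injective; ↑ʳ-injective; splitAt⁻¹-↑ˡ; splitAt⁻¹-↑ʳ; all?)
  renaming (_≟_ to _≟ᶠ_)
open import Data.Maybe as Maybe using (Maybe; just; nothing)
open import Data.Nat using (ℕ; zero; suc; _+_; _*_; _≤_; _<_; _⊔_; z≤n; s≤s; z<s; _<?_; _≟_)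
open import Data.Nat.Properties hiding (suc-injective)
open import Data.Nat.Tactic.RingSolver using (solve-∀)
open import Algebra.Properties.CommutativeSemigroup +-commutativeSemigroup using (interchange)
open import Data.Product using (Σ; ∃; _×_; _,_; proj₁; proj₂)
open import Data.Sum using (inj₁; inj₂; [_,_])
open import Data.Vec.Functional using (_∷_; _++_)
open import Data.Vec.Functional.Properties using (∷-cong)
open import Function using (_∘_; Injective; Equivalence)
open import Relation.Nullary using (Dec; yes; no; isYes; ¬?; contradiction)
open import Relation.Nullary.Decidable using (⌊_⌋; toWitness; False; toWitnessFalse; map′; _×-dec_; _⊎-dec_)
open import Relation.Binary.PropositionalEquality
  using (_≡_; _≢_; refl; sym; trans; cong; cong₂; subst; subst₂; _≗_)

private
  variable
    m n k : ℕ
    A B : Set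

sameColour : Bool → Bool → Bool
sameColour a b = ⌊ a ≟ᵇ b ⌋

sameColour-refl : ∀ b → sameColour b b ≡ true
sameColour-refl false = refl
sameColour-refl true  = refl

sameColour-∘-injective : ∀ {σ : Bool → Bool} → Injective _≡_ _≡_ σ →
                         ∀ a b → sameColour (σ a) (σ b) ≡ sameColour a b
sameColour-∘-injective {σ} inj a b with a ≟ᵇ b | σ a ≟ᵇ σ b
... | yes _   | yes _   = refl
... | yes a≡b | no σa≢σb = contradiction (cong σ a≡b) σa≢σb
... | no a≢b  | yes σa≡σb = contradiction (inj σa≡σb) a≢b
... | no _    | no _    = refl

sameColour-injective : ∀ a → Injective _≡_ _≡_ (sameColour a)
sameColour-injective false {false} {false} _ = refl
sameColour-injective false {true}  {true}  _ = refl
sameColour-injective true  {false} {false} _ = refl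
sameColour-injective true  {true}  {true}  _ = refl
sameColour-injective false {false} {true}  ()
sameColour-injective false {true}  {false} ()
sameColour-injective true  {false} {true}  ()
sameColour-injective true  {true}  {false} ()

count-cong : {c c′ : Coloring n} → c ≗ c′ → ∀ col → count c col ≡ count c′ col
count-cong {zero}  _     _   = refl
count-cong {suc n} c≗c′ col =
  cong₂ _+_ (cong (λ b → if sameColour b col then 1 else 0) (c≗c′ zero)) (count-cong (c≗c′ ∘ suc) col)

count-↑ : ∀ m (c : Coloring (m + n)) col →
          count c col ≡ count (c ∘ (_↑ˡ n)) col + count (c ∘ (m ↑ʳ_)) col
count-↑ zero    c col = refl
count-↑ {n} (suc m) c col =
  trans (cong (h +_) (count-↑ m (c ∘ suc) col))
        (sym (+-assoc h (count (c ∘ suc ∘ (_↑ˡ n)) col) (count (c ∘ suc ∘ (m ↑ʳ_)) col)))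
  where h = if sameColour (c zero) col then 1 else 0

count-∘-injective : ∀ {σ : Bool → Bool} → Injective _≡_ _≡_ σ →
                    (c : Coloring n) → ∀ b → count (σ ∘ c) (σ b) ≡ count c b
count-∘-injective {zero}  inj c b = refl
count-∘-injective {suc n} inj c b =
  cong₂ (λ x y → (if x then 1 else 0) + y)
        (sameColour-∘-injective inj (c zero) b) (count-∘-injective inj (c ∘ suc) b)

count-complement : (c : Coloring n) → ∀ b → count c b + count c (not b) ≡ n
count-complement {zero}  c b = refl
count-complement {suc n} c b =
  trans (interchange (indicator b) (count (c ∘ suc) b) (indicator (not b)) (count (c ∘ suc) (not b)))
        (cong₂ _+_ (indicators (c zero) b) (count-complement (c ∘ suc) b))
  where
  indicator : Bool → ℕ
  indicator col = if sameColour (c zero) col then 1 else 0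
  indicators : ∀ a b → (if sameColour a b then 1 else 0) + (if sameColour a (not b) then 1 else 0) ≡ 1
  indicators false false = refl
  indicators false true  = refl
  indicators true  false = refl
  indicators true  true  = refl

count-tail≤ : (c : Coloring (suc n)) → ∀ col → count (c ∘ suc) col ≤ count c col
count-tail≤ c col = m≤n+m _ _

count>0⇒∃ : (c : Coloring n) → ∀ b → 0 < count c b → ∃ λ i → c i ≡ b
count>0⇒∃ {suc n} c b pos with c zero ≟ᵇ b
... | yes c₀≡b = zero , c₀≡b
... | no  _    = let i , cᵢ≡b = count>0⇒∃ (c ∘ suc) b pos in suc i , cᵢ≡b

Output : ℕ → Set
Output n = Maybe (Fin n)

CorrectOutput-cong : {c c′ : Coloring n} → c ≗ c′ → ∀ o → CorrectOutput c o → CorrectOutput c′ o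
CorrectOutput-cong {n} {c} {c′} c≗c′ (just i) maj =
  subst (λ x → n < 2 * x) (trans (cong (count c) (c≗c′ i)) (count-cong c≗c′ (c′ i))) maj
CorrectOutput-cong {n} c≗c′ nothing noMaj (col , maj) =
  noMaj (col , subst (λ x → n < 2 * x) (sym (count-cong c≗c′ col)) maj)

CorrectOutput-recolour : ∀ {σ : Bool → Bool} → Injective _≡_ _≡_ σ →
                         (c : Coloring n) → ∀ o → CorrectOutput (σ ∘ c) o → CorrectOutput c o
CorrectOutput-recolour {n} inj c (just i) maj = subst (λ x → n < 2 * x) (count-∘-injective inj c (c i)) maj
CorrectOutput-recolour {n} {σ} inj c nothing noMaj (col , maj) =
  noMaj (σ col , subst (λ x → n < 2 * x) (sym (count-∘-injective inj c col)) maj)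

majority⇒count>0 : ∀ x → n < 2 * x → 0 < x
majority⇒count>0 (suc x) _ = z<s

majorityBall : (c : Coloring n) → ∀ b → IsMajority c b → ∃ λ i → IsMajority c (c i)
majorityBall {n} c b maj =
  let i , cᵢ≡b = count>0⇒∃ c b (majority⇒count>0 _ maj)
  in i , subst (λ b → n < 2 * count c b) (sym cᵢ≡b) maj

knownMajority : (c : Coloring n) → Σ (Output n) (CorrectOutput c)
knownMajority {n} c with n <? 2 * count c true | n <? 2 * count c false
... | yes maj   | _         = let i , p = majorityBall c true maj in just i , p
... | no _      | yes maj   = let i , p = majorityBall c false maj in just i , p
... | no ¬maj₁  | no ¬maj₂  = nothing , λ { (true , maj) → ¬maj₁ maj ; (false , maj) → ¬maj₂ maj }

CorrectOutput-discard : ∀ d {c : Coloring (2 * d + k)} (e : Fin k → Fin (2 * d + k)) →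
                        (∀ col → count c col ≡ d + count (c ∘ e) col) →
                        ∀ o → CorrectOutput (c ∘ e) o → CorrectOutput c (Maybe.map e o)
CorrectOutput-discard {k} d {c} e count≡ (just i) maj =
  subst (λ x → 2 * d + k < 2 * x) (sym (count≡ (c (e i))))
        (subst (2 * d + k <_) (sym (*-distribˡ-+ 2 d _)) (+-monoʳ-< (2 * d) maj))
CorrectOutput-discard {k} d {c} e count≡ nothing noMaj (col , maj) =
  noMaj (col , +-cancelˡ-< (2 * d) k _
                 (subst (2 * d + k <_) (*-distribˡ-+ 2 d _) (subst (λ x → 2 * d + k < 2 * x) (count≡ col) maj)))

extendOutput : Output n → Output (suc n)
extendOutput nothing  = just zero
extendOutput (just i) = just (suc i)

CorrectOutput-extend : ∀ h (c : Coloring (suc (2 * h))) o →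
                       CorrectOutput (c ∘ suc) o → CorrectOutput c (extendOutput o)
CorrectOutput-extend h c (just i) maj = begin-strict
  suc (2 * h)             <⟨ subst (suc (2 * h) <_) (sym (*-suc 2 h)) (n<1+n _) ⟩
  2 * suc h               ≤⟨ *-monoʳ-≤ 2 h<x ⟩
  2 * x                   ≤⟨ *-monoʳ-≤ 2 (count-tail≤ c (c (suc i))) ⟩
  2 * count c (c (suc i)) ∎
  where
  open ≤-Reasoning
  x = count (c ∘ suc) (c (suc i))
  h<x : h < x
  h<x = *-cancelˡ-< 2 h x maj
CorrectOutput-extend h c nothing noMaj = begin-strict
  suc (2 * h)             <⟨ subst (suc (2 * h) <_) (sym (*-suc 2 h)) (n<1+n _) ⟩
  2 * suc h               ≤⟨ *-monoʳ-≤ 2 (s≤s h≤t) ⟩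
  2 * suc t               ≡⟨ cong (λ b → 2 * ((if b then 1 else 0) + t)) (sameColour-refl (c zero)) ⟨
  2 * count c (c zero)    ∎
  where
  open ≤-Reasoning
  t = count (c ∘ suc) (c zero)
  f = count (c ∘ suc) (not (c zero))
  f≤h : f ≤ h
  f≤h = *-cancelˡ-≤ 2 (≮⇒≥ λ maj → noMaj (not (c zero) , maj))
  h≤t : h ≤ t
  h≤t = ≮⇒≥ λ t<h → <-irrefl (trans (count-complement (c ∘ suc) (c zero)) (cong (h +_) (+-identityʳ h)))
                              (+-mono-<-≤ t<h f≤h)

hasMajority? : (c : Coloring n) → Dec (HasMajority c)
hasMajority? {n} c =
  map′ [ (true ,_) , (false ,_) ] (λ { (true , maj) → inj₁ maj ; (false , maj) → inj₂ maj })
       ((n <? 2 * count c true) ⊎-dec (n <? 2 * count c false))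

correctOutput? : (c : Coloring n) → ∀ o → Dec (CorrectOutput c o)
correctOutput? {n} c (just i) = n <? 2 * count c (c i)
correctOutput? c nothing      = ¬? (hasMajority? c)

record Triple (n : ℕ) : Set where
  constructor triple
  field
    ball₁ ball₂ ball₃ : Fin n
    ball₁≢ball₂ : ball₁ ≢ ball₂
    ball₁≢ball₃ : ball₁ ≢ ball₃
    ball₂≢ball₃ : ball₂ ≢ ball₃

⟨_,_,_⟩ : (a b d : Fin n) → {False (a ≟ᶠ b)} → {False (a ≟ᶠ d)} → {False (b ≟ᶠ d)} → Triple n
⟨ a , b , d ⟩ {a≢b} {a≢d} {b≢d} =
  triple a b d (toWitnessFalse a≢b) (toWitnessFalse a≢d) (toWitnessFalse b≢d)

answer : Coloring n → Triple n → Bool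
answer c (triple a b d _ _ _) = tripleAnswer c a b d

relabelTriple : (e : Fin m → Fin n) → Injective _≡_ _≡_ e → Triple m → Triple n
relabelTriple e inj (triple a b d a≢b a≢d b≢d) =
  triple (e a) (e b) (e d) (a≢b ∘ inj) (a≢d ∘ inj) (b≢d ∘ inj)

data Tree (n : ℕ) (A : Set) : Set where
  done : A → Tree n A
  ask  : Triple n → (Bool → Tree n A) → Tree n A

runTree : Tree n A → Coloring n → A
runTree (done x)  c = x
runTree (ask q k) c = runTree (k (answer c q)) c

depthTree : Tree n A → ℕ
depthTree (done _)  = 0
depthTree (ask _ k) = suc (depthTree (k true) ⊔ depthTree (k false))

SolvesTree : Tree n (Output n) → Set
SolvesTree {n} t = (c : Coloring n) → CorrectOutput c (runTree t c)

runTree-cong : (t : Tree n A) {c c′ : Coloring n} → c ≗ c′ → runTree t c ≡ runTree t c′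
runTree-cong (done x) c≗c′ = refl
runTree-cong (ask q@(triple a b d _ _ _) k) {c} {c′} c≗c′ =
  trans (cong (λ x → runTree (k x) c) answer≡) (runTree-cong (k (answer c′ q)) c≗c′)
  where
  answer≡ : answer c q ≡ answer c′ q
  answer≡ rewrite c≗c′ a | c≗c′ b | c≗c′ d = refl

_>>=_ : Tree n A → (A → Tree n B) → Tree n B
done x  >>= f = f x
ask q k >>= f = ask q (λ a → k a >>= f)

mapTree : (A → B) → Tree n A → Tree n B
mapTree f t = t >>= (done ∘ f)

runTree->>= : (t : Tree n A) (f : A → Tree n B) (c : Coloring n) →
              runTree (t >>= f) c ≡ runTree (f (runTree t c)) c
runTree->>= (done x)  f c = refl
runTree->>= (ask q k) f c = runTree->>= (k (answer c q)) f c

runTree-mapTree : (f : A → B) (t : Tree n A) (c : Coloring n) →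
                  runTree (mapTree f t) c ≡ f (runTree t c)
runTree-mapTree f t = runTree->>= t (done ∘ f)

depthTree->>= : (t : Tree n A) (f : A → Tree n B) {b : ℕ} → (∀ x → depthTree (f x) ≤ b) →
                depthTree (t >>= f) ≤ depthTree t + b
depthTree->>= (done x)  f f≤b = f≤b x
depthTree->>= (ask q k) f {b} f≤b = s≤s (⊔-lub
  (≤-trans (depthTree->>= (k true) f f≤b)  (+-monoˡ-≤ b (m≤m⊔n _ _)))
  (≤-trans (depthTree->>= (k false) f f≤b) (+-monoˡ-≤ b (m≤n⊔m _ _))))

depthTree-mapTree : (f : A → B) (t : Tree n A) → depthTree (mapTree f t) ≡ depthTree t
depthTree-mapTree f (done x)  = refl
depthTree-mapTree f (ask q k) =
  cong suc (cong₂ _⊔_ (depthTree-mapTree f (k true)) (depthTree-mapTree f (k false)))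

relabel : (e : Fin m → Fin n) → Injective _≡_ _≡_ e → Tree m A → Tree n A
relabel e inj (done x)  = done x
relabel e inj (ask q k) = ask (relabelTriple e inj q) (relabel e inj ∘ k)

runTree-relabel : (e : Fin m → Fin n) (inj : Injective _≡_ _≡_ e) (t : Tree m A) (c : Coloring n) →
                  runTree (relabel e inj t) c ≡ runTree t (c ∘ e)
runTree-relabel e inj (done x) c = refl
runTree-relabel e inj (ask q@(triple _ _ _ _ _ _) k) c = runTree-relabel e inj (k (answer (c ∘ e) q)) c

depthTree-relabel : (e : Fin m → Fin n) (inj : Injective _≡_ _≡_ e) (t : Tree m A) →
                    depthTree (relabel e inj t) ≡ depthTree t
depthTree-relabel e inj (done x)  = refl
depthTree-relabel e inj (ask q k) =
  cong suc (cong₂ _⊔_ (depthTree-relabel e inj (k true)) (depthTree-relabel e inj (k false)))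

liftTree : (e : Fin m → Fin n) → Injective _≡_ _≡_ e → Tree m (Output m) → Tree n (Output n)
liftTree e inj t = mapTree (Maybe.map e) (relabel e inj t)

runTree-liftTree : (e : Fin m → Fin n) (inj : Injective _≡_ _≡_ e) (t : Tree m (Output m))
                   (c : Coloring n) →
                   runTree (liftTree e inj t) c ≡ Maybe.map e (runTree t (c ∘ e))
runTree-liftTree e inj t c =
  trans (runTree-mapTree (Maybe.map e) (relabel e inj t) c) (cong (Maybe.map e) (runTree-relabel e inj t c))

depthTree-liftTree : (e : Fin m → Fin n) (inj : Injective _≡_ _≡_ e) (t : Tree m (Output m)) →
                     depthTree (liftTree e inj t) ≡ depthTree t
depthTree-liftTree e inj t =
  trans (depthTree-mapTree (Maybe.map e) (relabel e inj t)) (depthTree-relabel e inj t)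

queryEach : (Fin k → Triple n) → Tree n (Fin k → Bool)
queryEach {zero}  qs = done λ ()
queryEach {suc k} qs = ask (qs zero) λ a → mapTree (a ∷_) (queryEach (qs ∘ suc))

runTree-queryEach : (qs : Fin k → Triple n) (c : Coloring n) → runTree (queryEach qs) c ≗ answer c ∘ qs
runTree-queryEach {suc k} qs c i
  rewrite runTree-mapTree (answer c (qs zero) ∷_) (queryEach (qs ∘ suc)) c with i
... | zero  = refl
... | suc j = runTree-queryEach (qs ∘ suc) c j

depthTree-queryEach : (qs : Fin k → Triple n) → depthTree (queryEach qs) ≡ k
depthTree-queryEach {zero}  qs = refl
depthTree-queryEach {suc k} qs = cong suc (trans (cong₂ _⊔_ d d) (⊔-idem k))
  where
  d : ∀ {a} → depthTree (mapTree (a ∷_) (queryEach (qs ∘ suc))) ≡ k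
  d {a} = trans (depthTree-mapTree (a ∷_) _) (depthTree-queryEach (qs ∘ suc))

toStrategy : Tree n (Output n) → Strategy n
toStrategy (done o) = leaf o
toStrategy (ask (triple a b d a≢b a≢d b≢d) k) =
  query a b d a≢b a≢d b≢d (toStrategy (k true)) (toStrategy (k false))

run-toStrategy : (t : Tree n (Output n)) (c : Coloring n) → run (toStrategy t) c ≡ runTree t c
run-toStrategy (done o) c = refl
run-toStrategy (ask (triple a b d _ _ _) k) c with tripleAnswer c a b d
... | true  = run-toStrategy (k true) c
... | false = run-toStrategy (k false) c

depth-toStrategy : (t : Tree n (Output n)) → depth (toStrategy t) ≡ depthTree t
depth-toStrategy (done o) = refl
depth-toStrategy (ask (triple _ _ _ _ _ _) k) =
  cong suc (cong₂ _⊔_ (depth-toStrategy (k true)) (depth-toStrategy (k false)))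

q3≤-tree : (t : Tree n (Output n)) → depthTree t ≤ k → SolvesTree t → q3≤ n k
q3≤-tree {k = k} t t≤k solves =
  toStrategy t , subst (_≤ k) (sym (depth-toStrategy t)) t≤k ,
  λ c → subst (CorrectOutput c) (sym (run-toStrategy t c)) (solves c)

padStrategy : Strategy n → Strategy (suc n)
padStrategy (leaf o) = leaf (extendOutput o)
padStrategy (query a b d a≢b a≢d b≢d ifYes ifNo) =
  query (suc a) (suc b) (suc d) (a≢b ∘ suc-injective) (a≢d ∘ suc-injective) (b≢d ∘ suc-injective)
        (padStrategy ifYes) (padStrategy ifNo)

run-padStrategy : (t : Strategy n) (c : Coloring (suc n)) →
                  run (padStrategy t) c ≡ extendOutput (run t (c ∘ suc))
run-padStrategy (leaf o) c = refl
run-padStrategy (query a b d _ _ _ ifYes ifNo) c with tripleAnswer c (suc a) (suc b) (suc d)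
... | true  = run-padStrategy ifYes c
... | false = run-padStrategy ifNo c

depth-padStrategy : (t : Strategy n) → depth (padStrategy t) ≡ depth t
depth-padStrategy (leaf o) = refl
depth-padStrategy (query _ _ _ _ _ _ ifYes ifNo) =
  cong suc (cong₂ _⊔_ (depth-padStrategy ifYes) (depth-padStrategy ifNo))

q3≤-suc-even : ∀ h → q3≤ (2 * h) k → q3≤ (suc (2 * h)) k
q3≤-suc-even {k} h (t , t≤k , solves) =
  padStrategy t , subst (_≤ k) (sym (depth-padStrategy t)) t≤k ,
  λ c → subst (CorrectOutput c) (sym (run-padStrategy t c))
              (CorrectOutput-extend h c _ (solves (c ∘ suc)))

-- Verification by exhaustion

everyColouring : ∀ n → (Coloring n → Bool) → Bool
everyColouring zero    p = p λ ()
everyColouring (suc n) p = everyColouring n (p ∘ (true ∷_)) ∧ everyColouring n (p ∘ (false ∷_))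

byExhaustion : {P : Coloring n → Set} → (∀ {c c′} → c ≗ c′ → P c → P c′) →
               (P? : ∀ c → Dec (P c)) → T (everyColouring n (isYes ∘ P?)) → ∀ c → P c
byExhaustion {zero} resp P? ok _ = resp (λ ()) (toWitness {a? = P? λ ()} ok)
byExhaustion {suc n} resp P? ok c with Equivalence.to T-∧ ok | c zero in c₀≡
... | okᵗ , _ | true  = resp (∷-cong (sym c₀≡) λ _ → refl)
                             (byExhaustion (resp ∘ ∷-cong refl) (P? ∘ (true ∷_)) okᵗ (c ∘ suc))
... | _ , okᶠ | false = resp (∷-cong (sym c₀≡) λ _ → refl)
                             (byExhaustion (resp ∘ ∷-cong refl) (P? ∘ (false ∷_)) okᶠ (c ∘ suc))

outcomes-byExhaustion : (t : Tree n A) {Q : Coloring n → A → Set} →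
                        (∀ {c c′} → c ≗ c′ → ∀ a → Q c a → Q c′ a) → (Q? : ∀ c a → Dec (Q c a)) →
                        T (everyColouring n λ c → isYes (Q? c (runTree t c))) → ∀ c → Q c (runTree t c)
outcomes-byExhaustion t {Q} resp Q? =
  byExhaustion (λ {c} {c′} c≗c′ q → subst (Q c′) (runTree-cong t c≗c′) (resp c≗c′ _ q))
               (λ c → Q? c (runTree t c))

-- Groups of four balls

Balanced : Coloring 4 → Set
Balanced c = ∀ col → count c col ≡ 2

data GroupOutcome : Set where
  balanced : GroupOutcome
  pair     : (x y : Fin 4) → x ≢ y → (relative : Coloring 4) → GroupOutcome

GroupOK : Coloring 4 → GroupOutcome → Set
GroupOK c balanced              = Balanced c
GroupOK c (pair x y _ relative) = c x ≡ c y × relative ≗ sameColour (c x) ∘ c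

GroupOK-cong : {c c′ : Coloring 4} → c ≗ c′ → ∀ r → GroupOK c r → GroupOK c′ r
GroupOK-cong c≗c′ balanced bal col = trans (sym (count-cong c≗c′ col)) (bal col)
GroupOK-cong c≗c′ (pair x y _ relative) (cx≡cy , rel) =
  trans (sym (c≗c′ x)) (trans cx≡cy (c≗c′ y)) ,
  λ j → trans (rel j) (cong₂ sameColour (c≗c′ x) (c≗c′ j))

balanced? : (c : Coloring 4) → Dec (Balanced c)
balanced? c = map′ (λ { (t , f) true → t ; (t , f) false → f }) (λ bal → bal true , bal false)
                   ((count c true ≟ 2) ×-dec (count c false ≟ 2))

groupOK? : (c : Coloring 4) → ∀ r → Dec (GroupOK c r)
groupOK? c balanced              = balanced? c
groupOK? c (pair x y _ relative) =
  (c x ≟ᵇ c y) ×-dec all? (λ j → relative j ≟ᵇ sameColour (c x) (c j))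

allBut : Fin 4 → Coloring 4
allBut i j = not ⌊ j ≟ᶠ i ⌋

groupTree : Tree 4 GroupOutcome
groupTree = ask ⟨ 0F , 1F , 2F ⟩ λ where
  true  → ask ⟨ 0F , 1F , 3F ⟩ λ where
    true  → done (pair 0F 1F (λ ()) (λ _ → true))
    false → done (pair 0F 1F (λ ()) (allBut 3F))
  false → ask ⟨ 0F , 1F , 3F ⟩ λ where
    true  → done (pair 0F 1F (λ ()) (allBut 2F))
    false → ask ⟨ 0F , 2F , 3F ⟩ λ where
      true  → done (pair 0F 2F (λ ()) (allBut 1F))
      false → ask ⟨ 1F , 2F , 3F ⟩ λ where
        true  → done (pair 1F 2F (λ ()) (allBut 0F))
        false → done balanced

groupTree-correct : ∀ c → GroupOK c (runTree groupTree c)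
groupTree-correct = outcomes-byExhaustion groupTree GroupOK-cong groupOK? _

count-balancedGroup : (c : Coloring (4 + k)) → Balanced (c ∘ (_↑ˡ k)) →
                      ∀ col → count c col ≡ 2 + count (c ∘ (4 ↑ʳ_)) col
count-balancedGroup c bal col = trans (count-↑ 4 c col) (cong (_+ count (c ∘ (4 ↑ʳ_)) col) (bal col))

↑ˡ≢↑ʳ : (i : Fin m) (j : Fin n) → i ↑ˡ n ≢ m ↑ʳ j
↑ˡ≢↑ʳ (suc i) j eq = ↑ˡ≢↑ʳ i j (suc-injective eq)

++-≗ : {u : Coloring m} {v : Coloring n} {w : Coloring (m + n)} →
       u ≗ w ∘ (_↑ˡ n) → v ≗ w ∘ (m ↑ʳ_) → u ++ v ≗ w
++-≗ {m} {w = w} u≗ v≗ i with splitAt m i in split≡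
... | inj₁ j = trans (u≗ j) (cong w (splitAt⁻¹-↑ˡ split≡))
... | inj₂ j = trans (v≗ j) (cong w (splitAt⁻¹-↑ʳ split≡))

tripleAnswer-pair : (c : Coloring n) {a b : Fin n} (d : Fin n) → c a ≡ c b →
                    tripleAnswer c a b d ≡ sameColour (c a) (c d)
tripleAnswer-pair c {b = b} d ca≡cb rewrite ca≡cb =
  cong (_∧ sameColour (c b) (c d)) (sameColour-refl (c b))

pairQueries : (x y : Fin 4) → x ≢ y → Fin k → Triple (4 + k)
pairQueries {k} x y x≢y j =
  triple (x ↑ˡ k) (y ↑ˡ k) (4 ↑ʳ j) (x≢y ∘ ↑ˡ-injective k x y) (↑ˡ≢↑ʳ x j) (↑ˡ≢↑ʳ y j)

pairFinish : (x y : Fin 4) → x ≢ y → Coloring 4 → Tree (4 + k) (Output (4 + k))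
pairFinish x y x≢y relative =
  mapTree (λ answers → proj₁ (knownMajority (relative ++ answers))) (queryEach (pairQueries x y x≢y))

pairFinish-correct : ∀ x y (x≢y : x ≢ y) relative (c : Coloring (4 + k)) →
                     GroupOK (c ∘ (_↑ˡ k)) (pair x y x≢y relative) →
                     CorrectOutput c (runTree (pairFinish x y x≢y relative) c)
pairFinish-correct {k} x y x≢y relative c (cx≡cy , rel) =
  subst (CorrectOutput c) (sym (runTree-mapTree _ (queryEach (pairQueries x y x≢y)) c))
    (CorrectOutput-recolour (sameColour-injective (c (x ↑ˡ k))) c _
      (CorrectOutput-cong K≗ _ (proj₂ (knownMajority K))))
  where
  K = relative ++ runTree (queryEach (pairQueries x y x≢y)) c
  K≗ : K ≗ sameColour (c (x ↑ˡ k)) ∘ c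
  K≗ = ++-≗ rel λ j →
    trans (runTree-queryEach (pairQueries x y x≢y) c j) (tripleAnswer-pair c (4 ↑ʳ j) cx≡cy)

afterGroup : Tree (4 + k) (Output (4 + k)) → GroupOutcome → Tree (4 + k) (Output (4 + k))
afterGroup onBalanced balanced                = onBalanced
afterGroup onBalanced (pair x y x≢y relative) = pairFinish x y x≢y relative

firstGroup : Tree (4 + k) GroupOutcome
firstGroup {k} = relabel (_↑ˡ k) (↑ˡ-injective k _ _) groupTree

groupStep : Tree (4 + k) (Output (4 + k)) → Tree (4 + k) (Output (4 + k))
groupStep onBalanced = firstGroup >>= afterGroup onBalanced

groupStep-correct : (onBalanced : Tree (4 + k) (Output (4 + k))) →
                    (∀ c → Balanced (c ∘ (_↑ˡ k)) → CorrectOutput c (runTree onBalanced c)) →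
                    SolvesTree (groupStep onBalanced)
groupStep-correct {k} onBalanced onBalanced-correct c =
  subst (CorrectOutput c) (sym run≡) (afterGroup-correct outcome (groupTree-correct (c ∘ (_↑ˡ k))))
  where
  outcome = runTree groupTree (c ∘ (_↑ˡ k))
  run≡ : runTree (groupStep onBalanced) c ≡ runTree (afterGroup onBalanced outcome) c
  run≡ = trans (runTree->>= firstGroup (afterGroup onBalanced) c)
               (cong (λ r → runTree (afterGroup onBalanced r) c) (runTree-relabel (_↑ˡ k) _ groupTree c))
  afterGroup-correct : ∀ r → GroupOK (c ∘ (_↑ˡ k)) r →
                       CorrectOutput c (runTree (afterGroup onBalanced r) c)
  afterGroup-correct balanced                = onBalanced-correct c
  afterGroup-correct (pair x y x≢y relative) = pairFinish-correct x y x≢y relative c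

groupStep-depth : ∀ {d} (onBalanced : Tree (4 + k) (Output (4 + k))) →
                  depthTree onBalanced ≤ d → k ≤ d → depthTree (groupStep onBalanced) ≤ 4 + d
groupStep-depth {d = d} onBalanced onBalanced≤d k≤d =
  depthTree->>= firstGroup (afterGroup onBalanced) afterGroup≤d
  where
  afterGroup≤d : ∀ r → depthTree (afterGroup onBalanced r) ≤ d
  afterGroup≤d balanced                = onBalanced≤d
  afterGroup≤d (pair x y x≢y relative) =
    subst (_≤ d) (sym (trans (depthTree-mapTree _ _) (depthTree-queryEach (pairQueries x y x≢y)))) k≤d

-- Sizes are m * 4 + n, not 4 * m + n, so that suc m * 4 + n reduces to 4 + (m * 4 + n).
scan : Tree n (Output n) → ∀ m → Tree (m * 4 + n) (Output (m * 4 + n))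
scan base zero    = base
scan base (suc m) = groupStep (liftTree (4 ↑ʳ_) (↑ʳ-injective 4 _ _) (scan base m))

scan-correct : (base : Tree n (Output n)) → SolvesTree base → ∀ m → SolvesTree (scan base m)
scan-correct base solves zero    = solves
scan-correct base solves (suc m) =
  groupStep-correct (liftTree (4 ↑ʳ_) _ (scan base m)) λ c bal →
    subst (CorrectOutput c) (sym (runTree-liftTree (4 ↑ʳ_) _ (scan base m) c))
      (CorrectOutput-discard 2 (4 ↑ʳ_) (count-balancedGroup c bal) _ (scan-correct base solves m (c ∘ (4 ↑ʳ_))))

scan-depth : ∀ {d} (base : Tree n (Output n)) → depthTree base ≤ d → n ≤ d →
             ∀ m → depthTree (scan base m) ≤ m * 4 + d
scan-depth base base≤d n≤d zero    = base≤d
scan-depth base base≤d n≤d (suc m) =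
  groupStep-depth (liftTree (4 ↑ʳ_) _ (scan base m))
    (subst (_≤ _) (sym (depthTree-liftTree (4 ↑ʳ_) _ (scan base m))) (scan-depth base base≤d n≤d m))
    (+-monoʳ-≤ (m * 4) n≤d)

q3≤-scan : ∀ {d} (base : Tree n (Output n)) → SolvesTree base → depthTree base ≤ d → n ≤ d →
           ∀ m → q3≤ (m * 4 + n) (m * 4 + d)
q3≤-scan base solves base≤d n≤d m =
  q3≤-tree (scan base m) (scan-depth base base≤d n≤d m) (scan-correct base solves m)

noBalls : Tree 0 (Output 0)
noBalls = done nothing

noBalls-correct : SolvesTree noBalls
noBalls-correct _ (_ , ())

-- When balls 0–3 split 2–2, a majority exists iff balls 4 and 5 agree, and has their colour.
balancedSixFinish : Tree 6 (Output 6)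
balancedSixFinish = ask ⟨ 0F , 1F , 4F ⟩ λ where
  true  → ask ⟨ 0F , 1F , 5F ⟩ λ where
    true  → done (just 0F)
    false → done nothing
  false → ask ⟨ 2F , 4F , 5F ⟩ λ where
    true  → done (just 2F)
    false → ask ⟨ 3F , 4F , 5F ⟩ λ where
      true  → done (just 3F)
      false → done nothing

sixBalls : Tree 6 (Output 6)
sixBalls = groupStep balancedSixFinish

sixBalls-correct : SolvesTree sixBalls
sixBalls-correct = outcomes-byExhaustion sixBalls CorrectOutput-cong correctOutput? _

sixBalls-depth : depthTree sixBalls ≤ 7
sixBalls-depth = groupStep-depth balancedSixFinish ≤-refl (n≤1+n 2)

lemma3p2 : (m : ℕ) → 1 ≤ m →
    q3≤ (4 * m) (4 * m) × q3≤ (4 * m + 1) (4 * m) ×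
    q3≤ (4 * m + 2) (4 * m + 3) × q3≤ (4 * m + 3) (4 * m + 3)
lemma3p2 (suc m) _ = q₀ , q₁ , q₂ , q₃
  where
  M = suc m
  e₀ : ∀ x → x * 4 + 0 ≡ 4 * x
  e₀ = solve-∀
  e₁ : ∀ x → 4 * x ≡ 2 * (2 * x)
  e₁ = solve-∀
  e₂ : ∀ x → suc (2 * (2 * x)) ≡ 4 * x + 1
  e₂ = solve-∀
  e₃ : ∀ x → x * 4 + 6 ≡ 4 * suc x + 2
  e₃ = solve-∀
  e₄ : ∀ x → x * 4 + 7 ≡ 4 * suc x + 3
  e₄ = solve-∀
  e₅ : ∀ x → 4 * x + 2 ≡ 2 * (2 * x + 1)
  e₅ = solve-∀
  e₆ : ∀ x → suc (2 * (2 * x + 1)) ≡ 4 * x + 3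
  e₆ = solve-∀
  q₀ : q3≤ (4 * M) (4 * M)
  q₀ = subst₂ q3≤ (e₀ M) (e₀ M) (q3≤-scan noBalls noBalls-correct z≤n z≤n M)
  q₁ : q3≤ (4 * M + 1) (4 * M)
  q₁ = subst₂ q3≤ (e₂ M) refl (q3≤-suc-even (2 * M) (subst₂ q3≤ (e₁ M) refl q₀))
  q₂ : q3≤ (4 * M + 2) (4 * M + 3)
  q₂ = subst₂ q3≤ (e₃ m) (e₄ m) (q3≤-scan sixBalls sixBalls-correct sixBalls-depth (n≤1+n 6) m)
  q₃ : q3≤ (4 * M + 3) (4 * M + 3)
  q₃ = subst₂ q3≤ (e₆ M) refl (q3≤-suc-even (2 * M + 1) (subst₂ q3≤ (e₅ M) refl q₂))
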